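{- Let $a$ and $m$ be positive integers and let $f_0(n)=\binom{a}{n-1}$ for $n=1,2,\ldots$. For $1\le k\le n$, $c_m(n,k)$ equals the number of words of length $n-1$ over the alphabet $\{0,1,\ldots,a+m-1\}$ that have exactly $k-1$ letters equal to $a+m-1$ and satisfy property $\mathcal P_1$.
   Context: For an arithmetic function $f_0$ defined on the positive integers, define recursively for $m\ge 1$: $c_m(n,k)=\sum_{i_1+\cdots+i_k=n} f_{m-1}(i_1)\cdots f_{m-1}(i_k)$, the sum over all $k$-tuples of positive integers $(i_1,\ldots,i_k)$ with sum $n$, and $f_m(n)=\sum_{k=1}^n c_m(n,k)$ (so $f_m$ is the $m$-th invert transform of $f_0$). A word over $\{0,1,\ldots,a+m-1\}$ satisfies property $\mathcal P_1$ if every maximal factor (block of consecutive letters) consisting only of letters from $\{0,1,\ldots,a-1\}$ has its letters in strictly ascending order. -}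

module Defs where

open import Data.Nat using (ℕ; zero; suc; _+_; _*_; _∸_; _<_; _≟_)
open import Data.Nat.Combinatorics using (_C_)
open import Data.List using (List; []; _∷_; map; concatMap; length; filter; upTo)
open import Data.Nat.ListAction using (sum; product)
open import Data.Fin using (Fin; toℕ)
open import Data.Vec using (Vec; []; _∷_)
open import Data.Product using (_×_)
open import Data.Unit using (⊤)
open import Relation.Nullary using (Dec; yes; no)
open import Relation.Nullary.Decidable using (_×-dec_)
open import Relation.Unary using (Decidable)

compositions : ℕ → ℕ → List (List ℕ)
compositions zero    zero    = [] ∷ []
compositions (suc n) zero    = []
compositions n       (suc k) =
  concatMap (λ j → map (suc j ∷_) (compositions (n ∸ suc j) k)) (upTo n)

cStep : (ℕ → ℕ) → ℕ → ℕ → ℕ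
cStep f n k = sum (map (λ t → product (map f t)) (compositions n k))

invert : (ℕ → ℕ) → ℕ → ℕ
invert f n = sum (map (λ j → cStep f n (suc j)) (upTo n))

fIter : (ℕ → ℕ) → ℕ → (ℕ → ℕ)
fIter f0 zero    = f0
fIter f0 (suc m) = invert (fIter f0 m)

cm : (ℕ → ℕ) → ℕ → ℕ → ℕ → ℕ
cm f0 m n k = cStep (fIter f0 (m ∸ 1)) n k

f0binom : ℕ → ℕ → ℕ
f0binom a n = a C (n ∸ 1)

allWords : (s ℓ : ℕ) → List (Vec (Fin s) ℓ)
allWords s zero    = [] ∷ []
allWords s (suc ℓ) =
  concatMap (λ x → map (x ∷_) (allWords s ℓ)) (Data.List.allFin s)
  where import Data.List

countLetter : ∀ {s ℓ} → ℕ → Vec (Fin s) ℓ → ℕ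
countLetter c []       = 0
countLetter c (x ∷ xs) with toℕ x ≟ c
... | yes _ = suc (countLetter c xs)
... | no  _ = countLetter c xs

-- Property P₁ (with small alphabet {0,…,a-1}): every maximal factor consisting
-- only of letters < a is strictly ascending.
P1 : ∀ {s ℓ} → ℕ → Vec (Fin s) ℓ → Set
P1 a []           = ⊤
P1 a (x ∷ [])     = ⊤
P1 a (x ∷ y ∷ xs) = (toℕ x < a → toℕ y < a → toℕ x < toℕ y) × P1 a (y ∷ xs)

private
  open import Data.Nat.Properties using (_<?_)
  open import Relation.Nullary using (¬_)
  open import Data.Unit using (tt)
  impl? : {A B : Set} → Dec A → Dec B → Dec (A → B)
  impl? _ (yes b) = yes (λ _ → b)
  impl? (yes a) (no ¬b) = no (λ f → ¬b (f a))
  impl? (no ¬a) _ = yes (λ a → Data.Empty.⊥-elim (¬a a))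
    where import Data.Empty

P1? : ∀ {s ℓ} (a : ℕ) → Decidable (P1 {s} {ℓ} a)
P1? a []           = yes Data.Unit.tt
P1? a (x ∷ [])     = yes Data.Unit.tt
P1? a (x ∷ y ∷ xs) =
  impl? (toℕ x <? a) (impl? (toℕ y <? a) (toℕ x <? toℕ y)) ×-dec P1? a (y ∷ xs)

countWords : (a m ℓ j : ℕ) → ℕ
countWords a m ℓ j =
  length (filter (λ w → P1? a w ×-dec ((countLetter (a + m ∸ 1) w) ≟ j))
                 (allWords (a + m) ℓ))

-- Let N = a + m − 1 be the top letter. Since N ≥ a, an occurrence of N never lies inside
-- a block of small letters, so a P₁-word with k − 1 occurrences of N splits at them into
-- k arbitrary P₁-words over {0, …, N − 1}. Hence c_m(n, k) counts these words as soon as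
-- f_{m−1}(i + 1) counts the P₁-words of length i over N letters; summing over k then shows
-- that f_m(i + 1) counts the P₁-words of length i over N + 1 letters. The induction starts
-- from f₀(i + 1) = binom(a, i), the number of strictly ascending words over a letters.
-- All counts are computed by transfer-matrix recursions in the length of the word,
-- indexed by the letter read last.
module Submission where

open import Algebra.Properties.CommutativeSemigroup using (interchange)
open import Data.Bool using (Bool; true; false; if_then_else_)
open import Data.Empty using (⊥; ⊥-elim)
open import Data.Fin using (Fin; toℕ; _↑ʳ_)
import Data.Fin as Fin
open import Data.Fin.Properties using (toℕ-↑ʳ)
open import Data.List using (List; []; _∷_; _++_; map; concatMap; applyUpTo; upTo; tabulate; allFin; filter; length)
open import Data.List.Properties using (map-++; map-∘; map-cong; map-upTo; map-tabulate)
open import Data.Nat using (ℕ; zero; suc; _+_; _*_; _∸_; _<_; _≤_; _≟_; z≤n; s≤s; s≤s⁻¹)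
open import Data.Nat.Combinatorics using (_C_; nCk+nC[k+1]≡[n+1]C[k+1])
open import Data.Nat.ListAction using (sum; product)
open import Data.Nat.ListAction.Properties using (sum-++)
open import Data.Nat.Properties
open import Data.Product using (_,_; proj₂)
open import Data.Product.Function.NonDependent.Propositional using (_×-⇔_)
open import Data.Unit using (tt)
open import Data.Vec using (Vec; []; _∷_)
open import Function.Bundles using (_⇔_; mk⇔)
open import Function.Construct.Identity using (⇔-id)
open import Relation.Binary.PropositionalEquality
open import Relation.Nullary using (Dec; does; yes; no)
open import Relation.Nullary.Decidable using (_×-dec_; _→-dec_; dec-true; dec-false; does-⇔)
open import Relation.Unary using (Decidable)

open import Defs

open ≡-Reasoning

∑< : ℕ → (ℕ → ℕ) → ℕ
∑< zero    f = 0
∑< (suc n) f = f 0 + ∑< n (λ i → f (suc i))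

syntax ∑< n (λ i → e) = ∑[ i < n ] e

∑-cong< : ∀ n {f g : ℕ → ℕ} → (∀ i → i < n → f i ≡ g i) → ∑< n f ≡ ∑< n g
∑-cong< zero    eq = refl
∑-cong< (suc n) eq = cong₂ _+_ (eq 0 (s≤s z≤n)) (∑-cong< n (λ i i<n → eq (suc i) (s≤s i<n)))

∑-cong : ∀ n {f g : ℕ → ℕ} → (∀ i → f i ≡ g i) → ∑< n f ≡ ∑< n g
∑-cong n eq = ∑-cong< n (λ i _ → eq i)

∑-zero : ∀ n → ∑[ i < n ] 0 ≡ 0
∑-zero zero    = refl
∑-zero (suc n) = ∑-zero n

∑-suc : ∀ n f → ∑< (suc n) f ≡ ∑< n f + f n
∑-suc zero    f = +-comm (f 0) 0
∑-suc (suc n) f = trans (cong (f 0 +_) (∑-suc n (λ i → f (suc i)))) (sym (+-assoc (f 0) _ _))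

∑-+ : ∀ m n f → ∑< (m + n) f ≡ ∑< m f + ∑[ i < n ] f (m + i)
∑-+ zero    n f = refl
∑-+ (suc m) n f = trans (cong (f 0 +_) (∑-+ m n (λ i → f (suc i)))) (sym (+-assoc (f 0) _ _))

∑-distrib-+ : ∀ n f g → ∑[ i < n ] (f i + g i) ≡ ∑< n f + ∑< n g
∑-distrib-+ zero    f g = refl
∑-distrib-+ (suc n) f g =
  trans (cong (f 0 + g 0 +_) (∑-distrib-+ n (λ i → f (suc i)) (λ i → g (suc i))))
        (interchange +-commutativeSemigroup (f 0) (g 0) _ _)

*-distribˡ-∑ : ∀ n c f → c * ∑< n f ≡ ∑[ i < n ] (c * f i)
*-distribˡ-∑ zero    c f = *-zeroʳ c
*-distribˡ-∑ (suc n) c f =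
  trans (*-distribˡ-+ c (f 0) _) (cong (c * f 0 +_) (*-distribˡ-∑ n c (λ i → f (suc i))))

*-distribʳ-∑ : ∀ n c f → ∑< n f * c ≡ ∑[ i < n ] (f i * c)
*-distribʳ-∑ n c f =
  trans (*-comm (∑< n f) c) (trans (*-distribˡ-∑ n c f) (∑-cong n (λ i → *-comm c (f i))))

∑-comm : ∀ m n (f : ℕ → ℕ → ℕ) → ∑[ i < m ] ∑[ j < n ] f i j ≡ ∑[ j < n ] ∑[ i < m ] f i j
∑-comm zero    n f = sym (∑-zero n)
∑-comm (suc m) n f =
  trans (cong (∑< n (f 0) +_) (∑-comm m n (λ i → f (suc i))))
        (sym (∑-distrib-+ n (f 0) (λ j → ∑[ i < m ] f (suc i) j)))

∑-*-∑-assoc : ∀ m n (f : ℕ → ℕ) (g : ℕ → ℕ → ℕ) (h : ℕ → ℕ) →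
  ∑[ i < m ] (f i * ∑[ j < n ] (g i j * h j)) ≡ ∑[ j < n ] (∑[ i < m ] (f i * g i j) * h j)
∑-*-∑-assoc m n f g h = begin
  ∑[ i < m ] (f i * ∑[ j < n ] (g i j * h j))
    ≡⟨ ∑-cong m (λ i → *-distribˡ-∑ n (f i) (λ j → g i j * h j)) ⟩
  ∑[ i < m ] ∑[ j < n ] (f i * (g i j * h j))
    ≡⟨ ∑-comm m n (λ i j → f i * (g i j * h j)) ⟩
  ∑[ j < n ] ∑[ i < m ] (f i * (g i j * h j))
    ≡⟨ ∑-cong n (λ j → trans (∑-cong m (λ i → sym (*-assoc (f i) (g i j) (h j))))
                              (sym (*-distribʳ-∑ m (h j) (λ i → f i * g i j)))) ⟩
  ∑[ j < n ] (∑[ i < m ] (f i * g i j) * h j) ∎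

∑-last≟ : ∀ N (F : ℕ → Bool → ℕ) → ∑[ y < suc N ] F y (does (y ≟ N)) ≡ ∑[ y < N ] F y false + F N true
∑-last≟ N F =
  trans (∑-suc N (λ y → F y (does (y ≟ N))))
        (cong₂ _+_ (∑-cong< N (λ y y<N → cong (F y) (dec-false (y ≟ N) (<⇒≢ y<N))))
                   (cong (F N) (dec-true (N ≟ N) refl)))

hockeyStick : ∀ ℓ r → ∑[ i < r ] ((r ∸ suc i) C ℓ) ≡ r C suc ℓ
hockeyStick ℓ zero    = refl
hockeyStick ℓ (suc r) = trans (cong (r C ℓ +_) (hockeyStick ℓ r)) (nCk+nC[k+1]≡[n+1]C[k+1] r ℓ)

sum-applyUpTo : ∀ n f → sum (applyUpTo f n) ≡ ∑< n f
sum-applyUpTo zero    f = refl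
sum-applyUpTo (suc n) f = cong (f 0 +_) (sum-applyUpTo n (λ i → f (suc i)))

sum-map-upTo : ∀ n f → sum (map f (upTo n)) ≡ ∑< n f
sum-map-upTo n f = trans (cong sum (map-upTo f n)) (sum-applyUpTo n f)

sum-tabulate-toℕ : ∀ n f → sum (tabulate {n = n} (λ i → f (toℕ i))) ≡ ∑< n f
sum-tabulate-toℕ zero    f = refl
sum-tabulate-toℕ (suc n) f = cong (f 0 +_) (sum-tabulate-toℕ n (λ i → f (suc i)))

sum-map-allFin : ∀ n f → sum (map (λ i → f (toℕ i)) (allFin n)) ≡ ∑< n f
sum-map-allFin n f =
  trans (cong sum (map-tabulate {n = n} (λ i → i) (λ i → f (toℕ i)))) (sum-tabulate-toℕ n f)

sum-map-concatMap : ∀ {A B : Set} (h : B → ℕ) (g : A → List B) xs →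
  sum (map h (concatMap g xs)) ≡ sum (map (λ x → sum (map h (g x))) xs)
sum-map-concatMap h g []       = refl
sum-map-concatMap h g (x ∷ xs) = begin
  sum (map h (g x ++ concatMap g xs))
    ≡⟨ cong sum (map-++ h (g x) (concatMap g xs)) ⟩
  sum (map h (g x) ++ map h (concatMap g xs))
    ≡⟨ sum-++ (map h (g x)) _ ⟩
  sum (map h (g x)) + sum (map h (concatMap g xs))
    ≡⟨ cong (sum (map h (g x)) +_) (sum-map-concatMap h g xs) ⟩
  sum (map (λ x → sum (map h (g x))) (x ∷ xs)) ∎

*-distribˡ-sum : ∀ {A : Set} c (f : A → ℕ) xs → c * sum (map f xs) ≡ sum (map (λ x → c * f x) xs)
*-distribˡ-sum c f []       = *-zeroʳ c
*-distribˡ-sum c f (x ∷ xs) = trans (*-distribˡ-+ c (f x) _) (cong (c * f x +_) (*-distribˡ-sum c f xs))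

𝟙 : ∀ {p} {P : Set p} → Dec P → ℕ
𝟙 P? = if does P? then 1 else 0

𝟙-⇔ : ∀ {p q} {P : Set p} {Q : Set q} → P ⇔ Q → (P? : Dec P) (Q? : Dec Q) → 𝟙 P? ≡ 𝟙 Q?
𝟙-⇔ P⇔Q P? Q? = cong (λ b → if b then 1 else 0) (does-⇔ P⇔Q P? Q?)

𝟙-yes : ∀ {p} {P : Set p} (P? : Dec P) → P → 𝟙 P? ≡ 1
𝟙-yes P? p rewrite dec-true P? p = refl

𝟙-no : ∀ {p} {P : Set p} (P? : Dec P) → (P → ⊥) → 𝟙 P? ≡ 0
𝟙-no P? ¬p rewrite dec-false P? ¬p = refl

𝟙-× : ∀ {p q} {P : Set p} {Q : Set q} (P? : Dec P) (Q? : Dec Q) → 𝟙 (P? ×-dec Q?) ≡ 𝟙 P? * 𝟙 Q?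
𝟙-× P? Q? with does P?
... | true  = sym (+-identityʳ _)
... | false = refl

length-filter≡sum-𝟙 : ∀ {A : Set} {P : A → Set} (P? : Decidable P) xs →
  length (filter P? xs) ≡ sum (map (λ x → 𝟙 (P? x)) xs)
length-filter≡sum-𝟙 P? []       = refl
length-filter≡sum-𝟙 P? (x ∷ xs) with does (P? x)
... | true  = cong suc (length-filter≡sum-𝟙 P? xs)
... | false = length-filter≡sum-𝟙 P? xs

shiftIf : Bool → (ℕ → ℕ) → ℕ → ℕ
shiftIf false g j       = g j
shiftIf true  g zero    = 0
shiftIf true  g (suc j) = g j

shiftIf-cong : ∀ b {g h : ℕ → ℕ} → (∀ i → g i ≡ h i) → ∀ j → shiftIf b g j ≡ shiftIf b h j
shiftIf-cong false eq j       = eq j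
shiftIf-cong true  eq zero    = refl
shiftIf-cong true  eq (suc j) = eq j

sum-map-shiftIf : ∀ {A : Set} b c (p : A → ℕ) (g : A → ℕ → ℕ) xs j →
  sum (map (λ x → c * p x * shiftIf b (g x) j) xs) ≡
  c * shiftIf b (λ i → sum (map (λ x → p x * g x i) xs)) j
sum-map-shiftIf false c p g xs j       = scale j
  where
  scale : ∀ i → sum (map (λ x → c * p x * g x i) xs) ≡ c * sum (map (λ x → p x * g x i) xs)
  scale i = trans (cong sum (map-cong (λ x → *-assoc c (p x) (g x i)) xs)) (sym (*-distribˡ-sum c _ xs))
sum-map-shiftIf true  c p g xs zero    =
  trans (cong sum (map-cong (λ x → *-zeroʳ (c * p x)) xs)) (trans (sum-zeros xs) (sym (*-zeroʳ c)))
  where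
  sum-zeros : ∀ {A : Set} (xs : List A) → sum (map (λ _ → 0) xs) ≡ 0
  sum-zeros []       = refl
  sum-zeros (_ ∷ xs) = sum-zeros xs
sum-map-shiftIf true  c p g xs (suc j) = sum-map-shiftIf false c p g xs j

cStep-zero : ∀ f p → cStep f p 0 ≡ 𝟙 (p ≟ 0)
cStep-zero f zero    = refl
cStep-zero f (suc p) = refl

cStep-suc : ∀ f n k → cStep f n (suc k) ≡ ∑[ i < n ] (f (suc i) * cStep f (n ∸ suc i) k)
cStep-suc f zero    k = refl
cStep-suc f (suc n) k = begin
  sum (map P (concatMap parts (upTo (suc n))))
    ≡⟨ sum-map-concatMap P parts (upTo (suc n)) ⟩
  sum (map (λ i → sum (map P (parts i))) (upTo (suc n)))
    ≡⟨ sum-map-upTo (suc n) (λ i → sum (map P (parts i))) ⟩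
  ∑[ i < suc n ] sum (map P (parts i))
    ≡⟨ ∑-cong (suc n) (λ i → trans (cong sum (sym (map-∘ {g = P} {f = suc i ∷_} (rest i))))
                                   (sym (*-distribˡ-sum (f (suc i)) P (rest i)))) ⟩
  ∑[ i < suc n ] (f (suc i) * cStep f (n ∸ i) k) ∎
  where
  P : List ℕ → ℕ
  P t = product (map f t)
  rest parts : ℕ → List (List ℕ)
  rest i = compositions (n ∸ i) k
  parts i = map (suc i ∷_) (rest i)

cStep-one : ∀ f ℓ → cStep f (suc ℓ) 1 ≡ f (suc ℓ)
cStep-one f ℓ =
  trans (cStep-suc f (suc ℓ) 0)
        (trans (∑-cong (suc ℓ) (λ i → cong (f (suc i) *_) (cStep-zero f (ℓ ∸ i))))
               (∑-diagonal ℓ (λ i → f (suc i))))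
  where
  ∑-diagonal : ∀ ℓ g → ∑[ i < suc ℓ ] (g i * 𝟙 (ℓ ∸ i ≟ 0)) ≡ g ℓ
  ∑-diagonal zero    g = trans (+-identityʳ _) (*-identityʳ (g 0))
  ∑-diagonal (suc ℓ) g = trans (cong (_+ ∑[ i < suc ℓ ] (g (suc i) * 𝟙 (ℓ ∸ i ≟ 0))) (*-zeroʳ (g 0)))
                               (∑-diagonal ℓ (λ i → g (suc i)))

module _ (a : ℕ) where

  adjacent? : ∀ x y → Dec (x < a → y < a → x < y)
  adjacent? x y = (x <? a) →-dec ((y <? a) →-dec (x <? y))

  adj : ℕ → ℕ → ℕ
  adj x y = 𝟙 (adjacent? x y)

  adj-fresh : ∀ {x} y → a ≤ x → adj x y ≡ 1
  adj-fresh y a≤x = 𝟙-yes (adjacent? _ y) (λ x<a → ⊥-elim (<⇒≱ x<a a≤x))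

  adj-to-fresh : ∀ x {y} → a ≤ y → adj x y ≡ 1
  adj-to-fresh x a≤y = 𝟙-yes (adjacent? x _) (λ _ y<a → ⊥-elim (<⇒≱ y<a a≤y))

  adj-ascent : ∀ {x y} → x < y → adj x y ≡ 1
  adj-ascent x<y = 𝟙-yes (adjacent? _ _) (λ _ _ → x<y)

  adj-descent : ∀ {x y} → x < a → y ≤ x → adj x y ≡ 0
  adj-descent x<a y≤x = 𝟙-no (adjacent? _ _) (λ p → <⇒≱ (p x<a (≤-<-trans y≤x x<a)) y≤x)

  -- p1Words N x ℓ counts the P₁-words of length ℓ over N letters that may follow the
  -- letter x, and p1WordsWith s t x ℓ j those over s letters with j occurrences of t.
  -- A letter x ≥ a constrains nothing, so it also stands for the beginning of a word.
  p1Words : (N x ℓ : ℕ) → ℕ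
  p1Words N x zero    = 1
  p1Words N x (suc ℓ) = ∑[ y < N ] (adj x y * p1Words N y ℓ)

  p1WordsWith : (s t x ℓ j : ℕ) → ℕ
  p1WordsWith s t x zero    j = 𝟙 (0 ≟ j)
  p1WordsWith s t x (suc ℓ) j = ∑[ y < s ] (adj x y * shiftIf (does (y ≟ t)) (p1WordsWith s t y ℓ) j)

  -- Words of length p over suc N letters that begin with N and contain N exactly suc j times.
  startingWithTop : (N p j : ℕ) → ℕ
  startingWithTop N zero    j = 0
  startingWithTop N (suc p) j = p1WordsWith (suc N) N N p j

  p1WordsWith-fresh : ∀ s t {x x'} → a ≤ x → a ≤ x' → ∀ ℓ j →
    p1WordsWith s t x ℓ j ≡ p1WordsWith s t x' ℓ j
  p1WordsWith-fresh s t a≤x a≤x' zero    j = refl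
  p1WordsWith-fresh s t a≤x a≤x' (suc ℓ) j =
    ∑-cong s (λ y → cong (_* _) (trans (adj-fresh y a≤x) (sym (adj-fresh y a≤x'))))

  ∑-p1WordsWith : ∀ s t ℓ J x → ℓ ≤ J → ∑[ j < suc J ] p1WordsWith s t x ℓ j ≡ p1Words s x ℓ
  ∑-p1WordsWith s t zero    J       x _         = cong suc (∑-zero J)
  ∑-p1WordsWith s t (suc ℓ) (suc J) x (s≤s ℓ≤J) = begin
    ∑[ j < suc (suc J) ] ∑[ y < s ] (adj x y * next y j)
      ≡⟨ ∑-comm (suc (suc J)) s (λ j y → adj x y * next y j) ⟩
    ∑[ y < s ] ∑[ j < suc (suc J) ] (adj x y * next y j)
      ≡⟨ ∑-cong s (λ y → trans (sym (*-distribˡ-∑ (suc (suc J)) (adj x y) (next y)))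
                               (cong (adj x y *_) (total y (does (y ≟ t))))) ⟩
    p1Words s x (suc ℓ) ∎
    where
    next : ℕ → ℕ → ℕ
    next y = shiftIf (does (y ≟ t)) (p1WordsWith s t y ℓ)
    total : ∀ y b → ∑[ j < suc (suc J) ] shiftIf b (p1WordsWith s t y ℓ) j ≡ p1Words s y ℓ
    total y true  = ∑-p1WordsWith s t ℓ J y ℓ≤J
    total y false = ∑-p1WordsWith s t ℓ (suc J) y (m≤n⇒m≤1+n ℓ≤J)

  p1WordsWith-zero : ∀ N x ℓ → p1WordsWith (suc N) N x ℓ 0 ≡ p1Words N x ℓ
  p1WordsWith-zero N x zero    = refl
  p1WordsWith-zero N x (suc ℓ) = begin
    ∑[ y < suc N ] (adj x y * shiftIf (does (y ≟ N)) (p1WordsWith (suc N) N y ℓ) 0)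
      ≡⟨ ∑-last≟ N (λ y b → adj x y * shiftIf b (p1WordsWith (suc N) N y ℓ) 0) ⟩
    ∑[ y < N ] (adj x y * p1WordsWith (suc N) N y ℓ 0) + adj x N * 0
      ≡⟨ cong₂ _+_ (∑-cong N (λ y → cong (adj x y *_) (p1WordsWith-zero N y ℓ))) (*-zeroʳ (adj x N)) ⟩
    p1Words N x (suc ℓ) + 0
      ≡⟨ +-identityʳ _ ⟩
    p1Words N x (suc ℓ) ∎

  -- Decomposition at the first occurrence of the top letter N, at position i.
  p1WordsWith-suc : ∀ {N} → a ≤ N → ∀ ℓ x j →
    p1WordsWith (suc N) N x ℓ (suc j) ≡ ∑[ i < suc ℓ ] (p1Words N x i * startingWithTop N (ℓ ∸ i) j)
  p1WordsWith-suc a≤N zero    x j = refl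
  p1WordsWith-suc {N} a≤N (suc ℓ) x j = begin
    ∑[ y < suc N ] (adj x y * shiftIf (does (y ≟ N)) (W y ℓ) (suc j))
      ≡⟨ ∑-last≟ N (λ y b → adj x y * shiftIf b (W y ℓ) (suc j)) ⟩
    ∑[ y < N ] (adj x y * W y ℓ (suc j)) + adj x N * W N ℓ j
      ≡⟨ cong₂ _+_ (∑-cong N (λ y → cong (adj x y *_) (p1WordsWith-suc a≤N ℓ y j)))
                   (trans (cong (_* W N ℓ j) (adj-to-fresh x a≤N)) (*-identityˡ _)) ⟩
    ∑[ y < N ] (adj x y * ∑[ i < suc ℓ ] (p1Words N y i * T (ℓ ∸ i))) + T (suc ℓ)
      ≡⟨ cong (_+ T (suc ℓ)) (∑-*-∑-assoc N (suc ℓ) (adj x) (p1Words N) (λ i → T (ℓ ∸ i))) ⟩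
    ∑[ i < suc ℓ ] (p1Words N x (suc i) * T (ℓ ∸ i)) + T (suc ℓ)
      ≡⟨ +-comm _ (T (suc ℓ)) ⟩
    T (suc ℓ) + ∑[ i < suc ℓ ] (p1Words N x (suc i) * T (ℓ ∸ i))
      ≡⟨ cong (_+ ∑[ i < suc ℓ ] (p1Words N x (suc i) * T (ℓ ∸ i))) (sym (*-identityˡ (T (suc ℓ)))) ⟩
    ∑[ i < suc (suc ℓ) ] (p1Words N x i * T (suc ℓ ∸ i)) ∎
    where
    W = p1WordsWith (suc N) N
    T : ℕ → ℕ
    T p = startingWithTop N p j

  ∑-adj-ascent : ∀ {x} → x < a → ∀ (g : ℕ → ℕ) →
    ∑[ y < a ] (adj x y * g y) ≡ ∑[ i < a ∸ suc x ] g (suc x + i)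
  ∑-adj-ascent {x} x<a g = begin
    ∑< a F
      ≡⟨ cong (λ n → ∑< n F) (sym (m+[n∸m]≡n x<a)) ⟩
    ∑< (suc x + (a ∸ suc x)) F
      ≡⟨ ∑-+ (suc x) (a ∸ suc x) F ⟩
    ∑< (suc x) F + ∑[ i < a ∸ suc x ] F (suc x + i)
      ≡⟨ cong₂ _+_ (trans (∑-cong< (suc x) (λ y y<1+x → cong (_* g y) (adj-descent x<a (s≤s⁻¹ y<1+x))))
                          (∑-zero (suc x)))
                   (∑-cong (a ∸ suc x) (λ i → trans (cong (_* g (suc x + i)) (adj-ascent (s≤s (m≤m+n x i))))
                                                     (*-identityˡ _))) ⟩
    ∑[ i < a ∸ suc x ] g (suc x + i) ∎
    where
    F : ℕ → ℕ
    F y = adj x y * g y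

  p1Words-ascending : ∀ ℓ {x} → x < a → p1Words a x ℓ ≡ (a ∸ suc x) C ℓ
  p1Words-ascending zero    x<a = refl
  p1Words-ascending (suc ℓ) {x} x<a = begin
    ∑[ y < a ] (adj x y * p1Words a y ℓ)
      ≡⟨ ∑-adj-ascent x<a (λ y → p1Words a y ℓ) ⟩
    ∑[ i < r ] p1Words a (suc x + i) ℓ
      ≡⟨ ∑-cong< r (λ i i<r → trans (p1Words-ascending ℓ (bound i<r)) (cong (_C ℓ) (index i))) ⟩
    ∑[ i < r ] ((r ∸ suc i) C ℓ)
      ≡⟨ hockeyStick ℓ r ⟩
    r C suc ℓ ∎
    where
    r = a ∸ suc x
    bound : ∀ {i} → i < r → suc x + i < a
    bound i<r = subst (_ <_) (m+[n∸m]≡n x<a) (+-monoʳ-< (suc x) i<r)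
    index : ∀ i → a ∸ suc (suc x + i) ≡ r ∸ suc i
    index i = trans (cong (a ∸_) (sym (+-suc (suc x) i))) (sym (∸-+-assoc a (suc x) (suc i)))

  p1Words-binomial : ∀ ℓ {x} → a ≤ x → p1Words a x ℓ ≡ a C ℓ
  p1Words-binomial zero    a≤x = refl
  p1Words-binomial (suc ℓ) a≤x =
    trans (∑-cong< a (λ y y<a → trans (cong (_* _) (adj-fresh y a≤x))
                                      (trans (*-identityˡ _) (p1Words-ascending ℓ y<a))))
          (hockeyStick ℓ a)

cStep-startingWithTop : ∀ a {N} → a ≤ N → ∀ f → (∀ i → f (suc i) ≡ p1Words a N N i) →
  ∀ k n → cStep f n (suc k) ≡ startingWithTop a N n k
cStep-startingWithTop a a≤N f f≡p1Words zero zero    = refl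
cStep-startingWithTop a {N} a≤N f f≡p1Words zero (suc ℓ) =
  trans (cStep-one f ℓ) (trans (f≡p1Words ℓ) (sym (p1WordsWith-zero a N N ℓ)))
cStep-startingWithTop a a≤N f f≡p1Words (suc k) zero    = refl
cStep-startingWithTop a {N} a≤N f f≡p1Words (suc k) (suc ℓ) =
  trans (cStep-suc f (suc ℓ) (suc k))
        (trans (∑-cong (suc ℓ) (λ i → cong₂ _*_ (f≡p1Words i)
                                             (cStep-startingWithTop a a≤N f f≡p1Words k (ℓ ∸ i))))
               (sym (p1WordsWith-suc a a≤N ℓ N k)))

fIter-p1Words : ∀ a m L {x} → a ≤ x → fIter (f0binom a) m (suc L) ≡ p1Words a (a + m) x L
fIter-p1Words a zero    L a≤x =
  trans (sym (p1Words-binomial a L a≤x)) (cong (λ N → p1Words a N _ L) (sym (+-identityʳ a)))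
fIter-p1Words a (suc m) L {x} a≤x = begin
  sum (map (λ j → cStep f (suc L) (suc j)) (upTo (suc L)))
    ≡⟨ sum-map-upTo (suc L) (λ j → cStep f (suc L) (suc j)) ⟩
  ∑[ j < suc L ] cStep f (suc L) (suc j)
    ≡⟨ ∑-cong (suc L) (λ j → trans (cStep-startingWithTop a a≤N f (λ i → fIter-p1Words a m i a≤N) j (suc L))
                                   (p1WordsWith-fresh a (suc N) N a≤N a≤x L j)) ⟩
  ∑[ j < suc L ] p1WordsWith a (suc N) N x L j
    ≡⟨ ∑-p1WordsWith a (suc N) N L L x ≤-refl ⟩
  p1Words a (suc N) x L
    ≡⟨ cong (λ N → p1Words a N x L) (sym (+-suc a m)) ⟩
  p1Words a (a + suc m) x L ∎
  where
  N = a + m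
  a≤N = m≤m+n a m
  f = fIter (f0binom a) m

module _ (a s t : ℕ) where

  countAfter : Fin s → (ℓ j : ℕ) → ℕ
  countAfter x ℓ j = sum (map (λ w → 𝟙 (P1? a (x ∷ w) ×-dec (countLetter t w ≟ j))) (allWords s ℓ))

  𝟙-P1-∷ : ∀ {ℓ} (x y : Fin s) (w : Vec (Fin s) ℓ) →
    𝟙 (P1? a (x ∷ y ∷ w)) ≡ adj a (toℕ x) (toℕ y) * 𝟙 (P1? a (y ∷ w))
  𝟙-P1-∷ x y w =
    trans (𝟙-⇔ (⇔-id _) (P1? a (x ∷ y ∷ w)) (adjacent? a (toℕ x) (toℕ y) ×-dec P1? a (y ∷ w)))
          (𝟙-× (adjacent? a (toℕ x) (toℕ y)) (P1? a (y ∷ w)))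

  𝟙-countLetter-∷ : ∀ {ℓ} (y : Fin s) (w : Vec (Fin s) ℓ) j →
    𝟙 (countLetter t (y ∷ w) ≟ j) ≡ shiftIf (does (toℕ y ≟ t)) (λ i → 𝟙 (countLetter t w ≟ i)) j
  𝟙-countLetter-∷ y w j with toℕ y ≟ t
  𝟙-countLetter-∷ y w zero    | yes y≡t rewrite dec-true (toℕ y ≟ t) y≡t = refl
  𝟙-countLetter-∷ y w (suc j) | yes y≡t rewrite dec-true (toℕ y ≟ t) y≡t = refl
  𝟙-countLetter-∷ y w j       | no  y≢t rewrite dec-false (toℕ y ≟ t) y≢t = refl

  countAfter≡p1WordsWith : ∀ ℓ x j → countAfter x ℓ j ≡ p1WordsWith a s t (toℕ x) ℓ j
  countAfter≡p1WordsWith zero    x j = +-identityʳ _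
  countAfter≡p1WordsWith (suc ℓ) x j = begin
    sum (map h (concatMap (λ y → map (y ∷_) ws) (allFin s)))
      ≡⟨ sum-map-concatMap h (λ y → map (y ∷_) ws) (allFin s) ⟩
    sum (map (λ y → sum (map h (map (y ∷_) ws))) (allFin s))
      ≡⟨ cong sum (map-cong firstLetter (allFin s)) ⟩
    sum (map (λ y → next (toℕ y)) (allFin s))
      ≡⟨ sum-map-allFin s next ⟩
    p1WordsWith a s t (toℕ x) (suc ℓ) j ∎
    where
    ws = allWords s ℓ
    h : Vec (Fin s) (suc ℓ) → ℕ
    h w = 𝟙 (P1? a (x ∷ w) ×-dec (countLetter t w ≟ j))
    next : ℕ → ℕ
    next y = adj a (toℕ x) y * shiftIf (does (y ≟ t)) (p1WordsWith a s t y ℓ) j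
    firstLetter : ∀ y → sum (map h (map (y ∷_) ws)) ≡ next (toℕ y)
    firstLetter y = begin
      sum (map h (map (y ∷_) ws))
        ≡⟨ cong sum (sym (map-∘ {g = h} {f = y ∷_} ws)) ⟩
      sum (map (λ w → h (y ∷ w)) ws)
        ≡⟨ cong sum (map-cong split ws) ⟩
      sum (map (λ w → c * 𝟙 (P1? a (y ∷ w)) * shiftIf b (counts w) j) ws)
        ≡⟨ sum-map-shiftIf b c (λ w → 𝟙 (P1? a (y ∷ w))) counts ws j ⟩
      c * shiftIf b (λ i → sum (map (λ w → 𝟙 (P1? a (y ∷ w)) * counts w i) ws)) j
        ≡⟨ cong (c *_) (shiftIf-cong b rest j) ⟩
      c * shiftIf b (p1WordsWith a s t (toℕ y) ℓ) j ∎
      where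
      c = adj a (toℕ x) (toℕ y)
      b = does (toℕ y ≟ t)
      counts : Vec (Fin s) ℓ → ℕ → ℕ
      counts w i = 𝟙 (countLetter t w ≟ i)
      split : ∀ w → h (y ∷ w) ≡ c * 𝟙 (P1? a (y ∷ w)) * shiftIf b (counts w) j
      split w = trans (𝟙-× (P1? a (x ∷ y ∷ w)) (countLetter t (y ∷ w) ≟ j))
                      (cong₂ _*_ (𝟙-P1-∷ x y w) (𝟙-countLetter-∷ y w j))
      rest : ∀ i →
        sum (map (λ w → 𝟙 (P1? a (y ∷ w)) * counts w i) ws) ≡ p1WordsWith a s t (toℕ y) ℓ i
      rest i = trans (cong sum (map-cong (λ w → sym (𝟙-× (P1? a (y ∷ w)) (countLetter t w ≟ i))) ws))
                     (countAfter≡p1WordsWith ℓ y i)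

P1⇔P1-fresh-∷ : ∀ a {s ℓ} (z : Fin s) → a ≤ toℕ z → (w : Vec (Fin s) ℓ) → P1 a w ⇔ P1 a (z ∷ w)
P1⇔P1-fresh-∷ a z a≤z []      = mk⇔ (λ _ → tt) (λ _ → tt)
P1⇔P1-fresh-∷ a z a≤z (y ∷ w) = mk⇔ (λ p → (λ z<a → ⊥-elim (<⇒≱ z<a a≤z)) , p) proj₂

countWords≡countAfter : ∀ a m (z : Fin (a + m)) → a ≤ toℕ z → ∀ ℓ j →
  countWords a m ℓ j ≡ countAfter a (a + m) (a + m ∸ 1) z ℓ j
countWords≡countAfter a m z a≤z ℓ j =
  trans (length-filter≡sum-𝟙 _ (allWords (a + m) ℓ))
        (cong sum (map-cong (λ w → 𝟙-⇔ (P1⇔P1-fresh-∷ a z a≤z w ×-⇔ ⇔-id _)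
                                       (P1? a w ×-dec counted w) (P1? a (z ∷ w) ×-dec counted w))
                            (allWords (a + m) ℓ)))
  where
  counted : (w : Vec (Fin (a + m)) ℓ) → Dec (countLetter (a + m ∸ 1) w ≡ j)
  counted w = countLetter (a + m ∸ 1) w ≟ j

mainTheorem1 : (a m : ℕ) → 1 ≤ a → 1 ≤ m → (n k : ℕ) → 1 ≤ k → k ≤ n →
    cm (f0binom a) m n k ≡ countWords a m (n ∸ 1) (k ∸ 1)
mainTheorem1 a (suc m) _ _ (suc ℓ) (suc k) _ _ = begin
  cStep (fIter (f0binom a) m) (suc ℓ) (suc k)
    ≡⟨ cStep-startingWithTop a a≤N (fIter (f0binom a) m) (λ i → fIter-p1Words a m i a≤N) k (suc ℓ) ⟩
  p1WordsWith a (suc N) N N ℓ k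
    ≡⟨ cong (λ s → p1WordsWith a s (s ∸ 1) N ℓ k) (sym (+-suc a m)) ⟩
  p1WordsWith a (a + suc m) (a + suc m ∸ 1) N ℓ k
    ≡⟨ p1WordsWith-fresh a (a + suc m) (a + suc m ∸ 1) a≤N a≤z ℓ k ⟩
  p1WordsWith a (a + suc m) (a + suc m ∸ 1) (toℕ z) ℓ k
    ≡⟨ sym (countAfter≡p1WordsWith a (a + suc m) (a + suc m ∸ 1) ℓ z k) ⟩
  countAfter a (a + suc m) (a + suc m ∸ 1) z ℓ k
    ≡⟨ sym (countWords≡countAfter a (suc m) z a≤z ℓ k) ⟩
  countWords a (suc m) ℓ k ∎
  where
  N = a + m
  a≤N = m≤m+n a m
  z : Fin (a + suc m)
  z = a ↑ʳ Fin.zero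
  a≤z : a ≤ toℕ z
  a≤z = subst (a ≤_) (sym (toℕ-↑ʳ a _)) (m≤m+n a 0)
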